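{- Let $G=(V,E)$ be a directed graph with $m=|E|$ and $c$ an interval function for $G$ of interval width $w$, and suppose $G$ has a $c$-respecting Eulerian trail. Then for every interval $T\subseteq[m]$ of consecutive integers, $|E(T)|\le |T|+2w-2$.
   Context: For $b\in\mathbb N$ let $[b]=\{1,\dots,b\}$. An interval function for $G$ assigns to each edge $e$ an interval $c(e)$ of consecutive integers in $[m]$ (possibly empty); its interval width is the maximum number of elements of $c(e)$ over $e\in E$. An edge $e$ is available at time step $t$ if $t\in c(e)$; for $T\subseteq[m]$, $E(T)$ denotes the set of edges available at at least one time step in $T$. An Eulerian trail is a sequence $e_1\dots e_m$ of edges forming a directed walk using every edge exactly once; it is $c$-respecting if $t\in c(e_t)$ for all $t\in[m]$. -}

module Defs where

open import Data.Nat using (ℕ; zero; suc; _+_; _*_; _∸_; _≤_; _≤?_; _⊔_)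
open import Data.Nat.Properties using ()
open import Data.Fin using (Fin; toℕ)
open import Data.List using (List; map; upTo; filter; length; foldr; allFin)
open import Data.List.Relation.Unary.Any using (Any; any?)
open import Data.Product using (_×_; Σ; _,_)
open import Data.Product.Properties using ()
open import Relation.Nullary using (Dec)
open import Relation.Nullary.Decidable using (_×-dec_)
open import Relation.Binary.PropositionalEquality using (_≡_)
open import Function.Bundles using (_↔_; Inverse)

record Digraph : Set where
  field
    n    : ℕ
    m    : ℕ
    tail : Fin m → Fin n
    head : Fin m → Fin n
open Digraph public

-- An interval of consecutive integers {lo, ..., hi}  (empty when hi < lo).
record Interval : Set where
  constructor [_,_]
  field
    lo : ℕ
    hi : ℕ
open Interval public

_∈I_ : ℕ → Interval → Set
t ∈I I = lo I ≤ t × t ≤ hi I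

_∈I?_ : (t : ℕ) (I : Interval) → Dec (t ∈I I)
t ∈I? I = (lo I ≤? t) ×-dec (t ≤? hi I)

size : Interval → ℕ
size I = suc (hi I) ∸ lo I

elems : Interval → List ℕ
elems I = map (lo I +_) (upTo (size I))

IntervalIn : ℕ → Interval → Set
IntervalIn m I = ∀ t → t ∈I I → 1 ≤ t × t ≤ m

IntervalFunction : Digraph → Set
IntervalFunction G = Fin (m G) → Interval

IsIntervalFunction : (G : Digraph) → IntervalFunction G → Set
IsIntervalFunction G c = ∀ e → IntervalIn (m G) (c e)

-- interval width: maximum size of c(e) over all edges (0 if no edges)
width : (G : Digraph) → IntervalFunction G → ℕ
width G c = foldr _⊔_ 0 (map (λ e → size (c e)) (allFin (m G)))

AvailableIn : (G : Digraph) → IntervalFunction G → Interval → Fin (m G) → Set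
AvailableIn G c T e = Any (λ t → t ∈I c e) (elems T)

availableIn? : (G : Digraph) (c : IntervalFunction G) (T : Interval)
               (e : Fin (m G)) → Dec (AvailableIn G c T e)
availableIn? G c T e = any? (λ t → t ∈I? c e) (elems T)

E[_] : (G : Digraph) → IntervalFunction G → Interval → List (Fin (m G))
E[ G ] c T = filter (availableIn? G c T) (allFin (m G))

-- An Eulerian trail: e_1 ... e_m, indexed by Fin m (position i is time step
-- toℕ i + 1), a bijection positions ↔ edges (every edge exactly once), and
-- consecutive edges form a directed walk.
record EulerianTrail (G : Digraph) : Set where
  field
    seq   : Fin (m G) ↔ Fin (m G)
open EulerianTrail public

trailEdge : {G : Digraph} → EulerianTrail G → Fin (m G) → Fin (m G)
trailEdge P = Inverse.to (seq P)

IsWalk : (G : Digraph) → EulerianTrail G → Set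
IsWalk G P = ∀ (i j : Fin (m G)) → toℕ j ≡ suc (toℕ i) →
             head G (trailEdge P i) ≡ tail G (trailEdge P j)

Respecting : (G : Digraph) → IntervalFunction G → EulerianTrail G → Set
Respecting G c P = ∀ (i : Fin (m G)) → suc (toℕ i) ∈I c (trailEdge P i)

-- Every edge of E(T) is traversed at a time step lying in its own interval,
-- which also meets T; an interval of size at most w containing a point of T
-- and a time step t forces t to lie within distance w − 1 of T.  The traversal
-- times of distinct edges are distinct, so E(T) injects into a window of
-- |T| + 2w − 2 consecutive time steps.
module Submission where

open import Defs
open import Data.Nat using (ℕ; zero; suc; _+_; _*_; _∸_; _≤_; _<_; _⊔_; z≤n; s≤s; s≤s⁻¹)
open import Data.Nat.Properties
open import Data.Fin using (Fin; toℕ)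
open import Data.Fin.Properties using (toℕ-injective)
open import Data.List using (List; []; _∷_; map; upTo; length; foldr; allFin)
open import Data.List.Properties using (length-map; length-upTo; length-removeAt′)
open import Data.List.Membership.Propositional using (_∈_; find)
open import Data.List.Membership.Propositional.Properties
  using (∈-map⁺; ∈-map⁻; ∈-upTo⁺; ∈-upTo⁻; ∈-allFin; ∈-filter⁻)
open import Data.List.Relation.Binary.Subset.Propositional using (_⊆_)
open import Data.List.Relation.Unary.Any using (here; there; _─_)
import Data.List.Relation.Unary.All as All
open import Data.List.Relation.Unary.AllPairs using (_∷_)
open import Data.List.Relation.Unary.Unique.Propositional using (Unique)
import Data.List.Relation.Unary.Unique.Propositional.Properties as Unique
open import Data.Product using (Σ; _×_; _,_)
open import Data.Empty using (⊥-elim)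
open import Function.Bundles using (Inverse)
open import Function.Definitions using (Injective)
open import Relation.Binary.PropositionalEquality
  using (_≡_; _≢_; refl; sym; cong; subst; module ≡-Reasoning)

∈-─ : ∀ {A : Set} {x y : A} (ys : List A) (x∈ys : x ∈ ys) →
      y ∈ ys → y ≢ x → y ∈ (ys ─ x∈ys)
∈-─ (_ ∷ _)  (here refl)  (here refl) y≢x = ⊥-elim (y≢x refl)
∈-─ (_ ∷ _)  (here refl)  (there y∈)  _   = y∈
∈-─ (_ ∷ _)  (there _)    (here y≡z)  _   = here y≡z
∈-─ (_ ∷ ys) (there x∈ys) (there y∈)  y≢x = there (∈-─ ys x∈ys y∈ y≢x)

Unique-⊆⇒length-≤ : ∀ {A : Set} {xs ys : List A} →
                    Unique xs → xs ⊆ ys → length xs ≤ length ys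
Unique-⊆⇒length-≤ {xs = []}     _              _     = z≤n
Unique-⊆⇒length-≤ {xs = x ∷ xs} {ys} (x∉xs ∷ u) xs⊆ys =
  subst (suc (length xs) ≤_) (sym (length-removeAt′ ys _))
    (s≤s (Unique-⊆⇒length-≤ u λ y∈xs →
      ∈-─ ys x∈ys (xs⊆ys (there y∈xs)) (λ y≡x → All.lookup x∉xs y∈xs (sym y≡x))))
  where x∈ys = xs⊆ys (here refl)

Unique-range⇒length-≤ : ∀ {a b} {xs : List ℕ} → Unique xs →
                        (∀ {x} → x ∈ xs → a ≤ x × x < b) → length xs ≤ b ∸ a
Unique-range⇒length-≤ {a} {b} {xs} u inRange = begin
  length xs                          ≤⟨ Unique-⊆⇒length-≤ u xs⊆range ⟩
  length (map (a +_) (upTo (b ∸ a))) ≡⟨ length-map (a +_) (upTo (b ∸ a)) ⟩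
  length (upTo (b ∸ a))              ≡⟨ length-upTo (b ∸ a) ⟩
  b ∸ a                              ∎
  where
  open ≤-Reasoning
  xs⊆range : xs ⊆ map (a +_) (upTo (b ∸ a))
  xs⊆range {x} x∈xs with a≤x , x<b ← inRange x∈xs =
    subst (_∈ map (a +_) (upTo (b ∸ a))) (m+[n∸m]≡n a≤x)
      (∈-map⁺ (a +_) (∈-upTo⁺ (∸-monoˡ-< x<b a≤x)))

i<n∸m⇒m+i<n : ∀ {i m n} → i < n ∸ m → m + i < n
i<n∸m⇒m+i<n {i} {m} {n} i<n∸m =
  subst (m + i <_) (m+[n∸m]≡n {m} {n} (<⇒≤ m<n)) (+-monoʳ-< m i<n∸m)
  where m<n = m∸n≢0⇒n<m {n} {m} (m<n⇒n≢0 i<n∸m)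

∈-elems⇒∈I : ∀ {t} (I : Interval) → t ∈ elems I → t ∈I I
∈-elems⇒∈I I t∈I with i , i∈ , refl ← ∈-map⁻ (lo I +_) t∈I =
  m≤m+n (lo I) i , s≤s⁻¹ (i<n∸m⇒m+i<n (∈-upTo⁻ i∈))

∈I-close : ∀ {x y w} (I : Interval) → x ∈I I → y ∈I I → size I ≤ w → x < y + w
∈I-close {x} {y} {w} I (_ , x≤hi) (lo≤y , y≤hi) size≤w = begin-strict
  x                      <⟨ s≤s x≤hi ⟩
  suc (hi I)             ≡⟨ m∸n+n≡m (m≤n⇒m≤1+n (≤-trans lo≤y y≤hi)) ⟨
  size I + lo I          ≤⟨ +-mono-≤ size≤w lo≤y ⟩
  w + y                  ≡⟨ +-comm w y ⟩
  y + w                  ∎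
  where open ≤-Reasoning

≤-foldr-⊔ : ∀ {x} (xs : List ℕ) → x ∈ xs → x ≤ foldr _⊔_ 0 xs
≤-foldr-⊔ (y ∷ _)  (here refl) = m≤m⊔n y _
≤-foldr-⊔ (y ∷ xs) (there x∈)  = m≤n⇒m≤o⊔n y (≤-foldr-⊔ xs x∈)

size≤width : (G : Digraph) (c : IntervalFunction G) (e : Fin (m G)) →
             size (c e) ≤ width G c
size≤width G c e = ≤-foldr-⊔ _ (∈-map⁺ (λ e → size (c e)) (∈-allFin e))

size-window≤ : ∀ lo hi s → hi + s ∸ suc lo ≤ size [ lo , hi ] + s ∸ 2
size-window≤ zero          hi      s = ≤-refl
size-window≤ (suc zero)    zero    s = ≤-refl
size-window≤ (suc (suc l)) zero    s = ∸-monoʳ-≤ s (s≤s (s≤s z≤n))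
size-window≤ (suc l)       (suc h) s = size-window≤ l h s

-- Times are shifted by w so that the lower end lo T − w + 1 of the window
-- needs no truncated subtraction.
module _ (G : Digraph) (c : IntervalFunction G)
         (time : Fin (m G) → ℕ) (time-injective : Injective _≡_ _≡_ time)
         (time∈c : ∀ e → time e ∈I c e) (T : Interval) where

  private w = width G c

  shifted-time∈window : ∀ {e} → e ∈ E[ G ] c T →
                        suc (lo T) ≤ time e + w × time e + w < hi T + w + w
  shifted-time∈window {e} e∈E
    with _ , available ← ∈-filter⁻ (availableIn? G c T) {xs = allFin (m G)} e∈E
    with t , t∈T , t∈c ← find available
    with lo≤t , t≤hi ← ∈-elems⇒∈I T t∈T =
    ≤-trans (s≤s lo≤t) (∈I-close (c e) t∈c (time∈c e) (size≤width G c e)) ,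
    +-monoˡ-< w (≤-trans (∈I-close (c e) (time∈c e) t∈c (size≤width G c e))
                         (+-monoˡ-≤ w t≤hi))

  length-E≤window : length (E[ G ] c T) ≤ hi T + w + w ∸ suc (lo T)
  length-E≤window =
    subst (_≤ hi T + w + w ∸ suc (lo T)) (length-map shifted (E[ G ] c T))
      (Unique-range⇒length-≤ unique inWindow)
    where
    shifted : Fin (m G) → ℕ
    shifted e = time e + w
    unique : Unique (map shifted (E[ G ] c T))
    unique = Unique.map⁺ (λ eq → time-injective (+-cancelʳ-≡ _ _ _ eq))
               (Unique.filter⁺ (availableIn? G c T) (Unique.allFin⁺ (m G)))
    inWindow : ∀ {x} → x ∈ map shifted (E[ G ] c T) → suc (lo T) ≤ x × x < hi T + w + w
    inWindow x∈ with e , e∈E , refl ← ∈-map⁻ shifted x∈ = shifted-time∈window e∈E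

trailTime : {G : Digraph} → EulerianTrail G → Fin (m G) → ℕ
trailTime P e = suc (toℕ (Inverse.from (seq P) e))

trailTime-injective : {G : Digraph} (P : EulerianTrail G) → Injective _≡_ _≡_ (trailTime P)
trailTime-injective P {x} {y} eq = begin
  x                   ≡⟨ strictlyInverseˡ x ⟨
  to (from x)         ≡⟨ cong to (toℕ-injective (suc-injective eq)) ⟩
  to (from y)         ≡⟨ strictlyInverseˡ y ⟩
  y                   ∎
  where open ≡-Reasoning
        open Inverse (seq P)

trailTime∈c : {G : Digraph} {c : IntervalFunction G} (P : EulerianTrail G) →
              Respecting G c P → ∀ e → trailTime P e ∈I c e
trailTime∈c {c = c} P respecting e =
  subst (λ e′ → trailTime P e ∈I c e′) (strictlyInverseˡ e) (respecting (from e))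
  where open Inverse (seq P)

lemma15 : (G : Digraph) (c : IntervalFunction G) → IsIntervalFunction G c →
          (w : ℕ) → width G c ≡ w →
          Σ (EulerianTrail G) (λ P → IsWalk G P × Respecting G c P) →
          (T : Interval) → IntervalIn (m G) T →
          length (E[ G ] c T) ≤ size T + 2 * w ∸ 2
lemma15 G c _ w refl (P , _ , respecting) T _ = begin
  length (E[ G ] c T)
    ≤⟨ length-E≤window G c (trailTime P) (trailTime-injective P) (trailTime∈c P respecting) T ⟩
  hi T + w + w ∸ suc (lo T)     ≡⟨ cong (_∸ suc (lo T)) (+-assoc (hi T) w w) ⟩
  hi T + (w + w) ∸ suc (lo T)   ≤⟨ size-window≤ (lo T) (hi T) (w + w) ⟩
  size T + (w + w) ∸ 2          ≡⟨ cong (λ s → size T + (w + s) ∸ 2) (+-identityʳ w) ⟨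
  size T + 2 * w ∸ 2            ∎
  where open ≤-Reasoning
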